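{- For every $n$, there is an injection from $\bar{Q}_2(0,n)$ to $\bar{P}_2(0,n)$.
   Context: Partitions: $\ell(\mu)$ is the number of parts, $s(\mu)$ the smallest part ($s(\emptyset)=+\infty$), $\mu_i=0$ if $\mu$ has fewer than $i$ parts, rank of $\lambda$ is $\lambda_1-\ell(\lambda)$. The rank-set of $\lambda=(\lambda_1\ge\cdots\ge\lambda_\ell>0)$ is $[-\lambda_1,1-\lambda_2,\ldots,\ell-1-\lambda_\ell,\ell,\ell+1,\ldots]$. The Durfee symbol of $\lambda$ is $(\alpha,\beta)_j$, where $j$ is the side of the Durfee square (largest $j$ with $\lambda_j\ge j$, or $0$), $\alpha_i=\lambda'_{j+i}$ are the column lengths to the right of the Durfee square ($\lambda'$ the conjugate) and $\beta=(\lambda_{j+1},\lambda_{j+2},\ldots)$ are the rows below it. $Q(0,n)$ is the set of partitions of $n$ with $0$ in the rank-set; $P(0,n)$ the set of partitions of $n$ with rank $\ge0$. $\bar{Q}_2(0,n)$ is the set of $\lambda\in Q(0,n)$ whose Durfee symbol satisfies $j\ge1$, $\ell(\beta)-\ell(\alpha)\ge1$, $\alpha_1=\alpha_2=\alpha_3=j$ and $s(\beta)\ge3$. $\bar{P}_2(0,n)$ is the set of $\mu\in P(0,n)$ whose Durfee symbol $(\gamma,\delta)_{j'}$ satisfies $j'\ge1$, $\ell(\gamma)=\ell(\delta)$, $\gamma_1=j'-2$, $\delta_1=j'$ and $s(\delta)\ge2$. -}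

module Defs where

open import Data.Nat using (ℕ; zero; suc; _+_; _∸_; _≤_; _<_; _≥_; _≤?_)
open import Data.Integer as ℤ using (ℤ; +_)
open import Data.List using (List; []; _∷_; length; map; filter; drop; upTo)
open import Data.Nat.ListAction using (sum)
open import Data.List.Relation.Unary.All using (All)
open import Data.List.Relation.Unary.Linked using (Linked)
open import Data.Product using (Σ; ∃; _×_; proj₁)
open import Data.Sum using (_⊎_)
open import Relation.Binary.PropositionalEquality using (_≡_)
import Relation.Nullary

IsPartition : List ℕ → Set
IsPartition l = Linked _≥_ l × All (λ x → 1 ≤ x) l

Partition : ℕ → Set
Partition n = Σ (List ℕ) (λ l → IsPartition l × sum l ≡ n)

-- μ_i (1-indexed), with μ_i = 0 if μ has fewer than i parts.
part : List ℕ → ℕ → ℕ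
part []       _             = 0
part (x ∷ xs) 0             = 0   -- index 0 is not used
part (x ∷ xs) 1             = x
part (x ∷ xs) (suc (suc i)) = part xs (suc i)

ℓ : List ℕ → ℕ
ℓ = length

conj : List ℕ → ℕ → ℕ
conj l k = length (filter (k ≤?_) l)

InRankSet : ℤ → List ℕ → Set
InRankSet k l =
  (Σ ℕ λ i → i < ℓ l × k ≡ (+ i) ℤ.- (+ part l (suc i)))
  ⊎ (Σ ℕ λ m → k ≡ + (ℓ l + m))

RankNonneg : List ℕ → Set
RankNonneg l = ℓ l ≤ part l 1

durfeeAux : ℕ → List ℕ → ℕ
durfeeAux i []       = 0
durfeeAux i (x ∷ xs) with i ≤? x
... | Relation.Nullary.yes _ = suc (durfeeAux (suc i) xs)
... | Relation.Nullary.no  _ = 0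

durfee : List ℕ → ℕ
durfee = durfeeAux 1

-- Durfee symbol components:
-- α_i = λ'_{j+i}, i = 1 .. λ_1 - j  (column lengths right of the square)
alpha : List ℕ → List ℕ
alpha l = map (λ i → conj l (durfee l + suc i)) (upTo (part l 1 ∸ durfee l))

beta : List ℕ → List ℕ
beta l = drop (durfee l) l

InQbar2 : List ℕ → Set
InQbar2 l =
  InRankSet (+ 0) l
  × 1 ≤ durfee l
  × 1 + ℓ (alpha l) ≤ ℓ (beta l)
  × part (alpha l) 1 ≡ durfee l
  × part (alpha l) 2 ≡ durfee l
  × part (alpha l) 3 ≡ durfee l
  × All (λ x → 3 ≤ x) (beta l)

-- P̄₂(0,n)   (γ_1 = j' - 2 written as γ_1 + 2 = j')
InPbar2 : List ℕ → Set
InPbar2 l =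
  RankNonneg l
  × 1 ≤ durfee l
  × ℓ (alpha l) ≡ ℓ (beta l)
  × part (alpha l) 1 + 2 ≡ durfee l
  × part (beta l) 1 ≡ durfee l
  × All (λ x → 2 ≤ x) (beta l)

Qbar2 : ℕ → Set
Qbar2 n = Σ (Partition n) (λ p → InQbar2 (proj₁ p))

Pbar2 : ℕ → Set
Pbar2 n = Σ (Partition n) (λ p → InPbar2 (proj₁ p))

parts : ∀ {n} {P : Partition n → Set} → Σ (Partition n) P → List ℕ
parts x = proj₁ (proj₁ x)

-- A partition λ ∈ Q̄₂(0,n) with Durfee side j splits as T ++ j ∷ B: the α-conditions put the j
-- rows of T in [j + 3, j + m], where m = ℓ(B), and the rank-set condition forces the row right
-- below the square to be exactly j (the only place a fixed point λ_{i+1} = i can sit), so B has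
-- parts in [3, j].  Removing j + 2 from each row of T gives A (j parts in [1, m − 2]); reading B
-- to the right of column 3 by columns gives F (j − 3 parts).  Crossing F with A minus its first
-- part yields A′ and B′ of lengths j − 2 and j − 1, and
--   μ = (j + 1 + m, j + 1 + A′, j + 1, j + 1, j + 1, 2 + the first m − 1 columns of B′)
-- has Durfee side j + 1, the shape required by P̄₂, and the weight of λ.
module Submission where

open import Defs
open import Data.Nat
open import Data.Nat.Properties
open import Data.Nat.ListAction using (sum)
open import Data.Nat.ListAction.Properties using (sum-++)
open import Data.Nat.Tactic.RingSolver using (solve-∀)
open import Algebra.Properties.CommutativeSemigroup +-commutativeSemigroup using (interchange; x∙yz≈y∙xz; x∙yz≈z∙yx)
open import Data.List using (List; []; _∷_; length; map; filter; _++_; drop; upTo; applyUpTo)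
open import Data.List.Properties
  using (length-map; length-++; length-upTo; map-applyUpTo; ++-assoc; map-injective; ∷-injective; ∷-injectiveˡ; ∷-injectiveʳ;
         filter-accept; filter-reject; filter-all; filter-none; filter-++; length-filter)
open import Data.List.Relation.Unary.All as All using (All; []; _∷_)
open import Data.List.Relation.Unary.All.Properties using (++⁺; ++⁻ˡ; map⁺)
open import Data.List.Relation.Unary.Linked as Linked using (Linked; []; [-]; _∷_)
import Data.List.Relation.Unary.Linked.Properties as Linked
open import Data.Product using (Σ; ∃; ∃₂; _×_; _,_; proj₁; proj₂; uncurry)
open import Data.Sum using (inj₁; inj₂)
open import Data.Empty using (⊥-elim)
open import Function using (id; _∘′_)
open import Relation.Nullary using (¬_; yes; no)
open import Relation.Binary.PropositionalEquality
open import Relation.Binary.Definitions using (tri<; tri≈; tri>)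
import Data.Integer as ℤ
import Data.Integer.Properties as ℤ

Decreasing : List ℕ → Set
Decreasing = Linked _≥_

decreasing⇒≤head : ∀ {x xs} → Decreasing (x ∷ xs) → All (_≤ x) xs
decreasing⇒≤head d = All.tail (Linked.Linked⇒All (λ p q → ≤-trans q p) ≤-refl d)

decreasing-head≤⇒≤ : ∀ {b x xs} → Decreasing (x ∷ xs) → x ≤ b → All (_≤ b) (x ∷ xs)
decreasing-head≤⇒≤ d x≤b = x≤b ∷ All.map (λ y≤x → ≤-trans y≤x x≤b) (decreasing⇒≤head d)

decreasing-∷ : ∀ {x xs} → All (_≤ x) xs → Decreasing xs → Decreasing (x ∷ xs)
decreasing-∷ []      _ = [-]
decreasing-∷ (p ∷ _) d = p ∷ d

decreasing-++ : ∀ {b xs ys} → Decreasing xs → Decreasing ys →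
                All (b ≤_) xs → All (_≤ b) ys → Decreasing (xs ++ ys)
decreasing-++ {xs = []}     _  dys _         _   = dys
decreasing-++ {xs = x ∷ xs} dx dys (b≤x ∷ bs) ys≤b =
  decreasing-∷ (++⁺ (decreasing⇒≤head dx) (All.map (λ y≤b → ≤-trans y≤b b≤x) ys≤b))
               (decreasing-++ (Linked.tail dx) dys bs ys≤b)

decreasing-++⁻ˡ : ∀ xs {ys} → Decreasing (xs ++ ys) → Decreasing xs
decreasing-++⁻ˡ []           _       = []
decreasing-++⁻ˡ (x ∷ [])     _       = [-]
decreasing-++⁻ˡ (x ∷ y ∷ xs) (p ∷ d) = p ∷ decreasing-++⁻ˡ (y ∷ xs) d

decreasing-++⁻ʳ : ∀ xs {ys} → Decreasing (xs ++ ys) → Decreasing ys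
decreasing-++⁻ʳ []       d = d
decreasing-++⁻ʳ (x ∷ xs) d = decreasing-++⁻ʳ xs (Linked.tail d)

decreasing-map-+ : ∀ c {xs} → Decreasing xs → Decreasing (map (c +_) xs)
decreasing-map-+ c d = Linked.map⁺ (Linked.map (+-monoʳ-≤ c) d)

decreasing-map-∸ : ∀ c {xs} → Decreasing xs → Decreasing (map (_∸ c) xs)
decreasing-map-∸ c d = Linked.map⁺ (Linked.map (∸-monoˡ-≤ c) d)

++-cancel-≡length : ∀ (xs₁ xs₂ : List ℕ) {ys₁ ys₂} → length xs₁ ≡ length xs₂ →
                    xs₁ ++ ys₁ ≡ xs₂ ++ ys₂ → xs₁ ≡ xs₂ × ys₁ ≡ ys₂
++-cancel-≡length []         []         _ e = refl , e
++-cancel-≡length (x₁ ∷ xs₁) (x₂ ∷ xs₂) l e with ∷-injective e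
... | refl , e′ with ++-cancel-≡length xs₁ xs₂ (suc-injective l) e′
...   | refl , ys≡ = refl , ys≡

conj-accept : ∀ {k x} xs → k ≤ x → conj (x ∷ xs) k ≡ suc (conj xs k)
conj-accept {k} xs k≤x = cong length (filter-accept (k ≤?_) {xs = xs} k≤x)

conj-reject : ∀ {k x} xs → ¬ k ≤ x → conj (x ∷ xs) k ≡ conj xs k
conj-reject {k} xs k≰x = cong length (filter-reject (k ≤?_) {xs = xs} k≰x)

conj-++ : ∀ xs ys k → conj (xs ++ ys) k ≡ conj xs k + conj ys k
conj-++ xs ys k = trans (cong length (filter-++ (k ≤?_) xs ys)) (length-++ (filter (k ≤?_) xs))

conj-all : ∀ {k} xs → All (k ≤_) xs → conj xs k ≡ length xs
conj-all {k} xs ks = cong length (filter-all (k ≤?_) ks)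

conj-none : ∀ {k} xs → All (_< k) xs → conj xs k ≡ 0
conj-none {k} xs ks = cong length (filter-none (k ≤?_) (All.map <⇒≱ ks))

conj≤length : ∀ xs k → conj xs k ≤ length xs
conj≤length xs k = length-filter (k ≤?_) xs

conj-∷ : ∀ x xs k → conj xs k ≤ conj (x ∷ xs) k
conj-∷ x xs k with k ≤? x
... | yes k≤x = ≤-trans (n≤1+n _) (≤-reflexive (sym (conj-accept xs k≤x)))
... | no  k≰x = ≤-reflexive (sym (conj-reject xs k≰x))

conj-antitone : ∀ xs {k k′} → k ≤ k′ → conj xs k′ ≤ conj xs k
conj-antitone []       _    = z≤n
conj-antitone (x ∷ xs) {k} {k′} k≤k′ with k′ ≤? x
... | yes k′≤x = begin
  conj (x ∷ xs) k′ ≡⟨ conj-accept xs k′≤x ⟩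
  suc (conj xs k′) ≤⟨ s≤s (conj-antitone xs k≤k′) ⟩
  suc (conj xs k)  ≡⟨ conj-accept xs (≤-trans k≤k′ k′≤x) ⟨
  conj (x ∷ xs) k  ∎
  where open ≤-Reasoning
... | no k′≰x = begin
  conj (x ∷ xs) k′ ≡⟨ conj-reject xs k′≰x ⟩
  conj xs k′       ≤⟨ conj-antitone xs k≤k′ ⟩
  conj xs k        ≤⟨ conj-∷ x xs k ⟩
  conj (x ∷ xs) k  ∎
  where open ≤-Reasoning

conj-threshold : ∀ k xs ys → All (k ≤_) xs → All (_< k) ys → conj (xs ++ ys) k ≡ length xs
conj-threshold k xs ys xs≥k ys<k = begin
  conj (xs ++ ys) k     ≡⟨ conj-++ xs ys k ⟩
  conj xs k + conj ys k ≡⟨ cong₂ _+_ (conj-all xs xs≥k) (conj-none ys ys<k) ⟩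
  length xs + 0         ≡⟨ +-identityʳ _ ⟩
  length xs             ∎
  where open ≡-Reasoning

split-threshold : ∀ k xs → Decreasing xs →
                  ∃₂ λ ys zs → xs ≡ ys ++ zs × All (k ≤_) ys × All (_< k) zs
split-threshold k []       _ = [] , [] , refl , [] , []
split-threshold k (x ∷ xs) d with k ≤? x
... | yes k≤x with split-threshold k xs (Linked.tail d)
...   | ys , zs , refl , ys≥k , zs<k = x ∷ ys , zs , refl , k≤x ∷ ys≥k , zs<k
split-threshold k (x ∷ xs) d | no k≰x =
  [] , x ∷ xs , refl , [] , x<k ∷ All.map (λ y≤x → ≤-<-trans y≤x x<k) (decreasing⇒≤head d)
  where x<k = ≰⇒> k≰x

conj-head< : ∀ {k x} xs → Decreasing (x ∷ xs) → x < k → conj (x ∷ xs) k ≡ 0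
conj-head< xs d x<k = conj-none (_ ∷ xs) (x<k ∷ All.map (λ y≤x → ≤-<-trans y≤x x<k) (decreasing⇒≤head d))

conj-injective : ∀ xs ys → Decreasing xs → Decreasing ys → (∀ k → conj xs k ≡ conj ys k) → xs ≡ ys
conj-injective []       []       _  _  _ = refl
conj-injective []       (y ∷ ys) _  _  h = ⊥-elim (0≢1+n (trans (h 0) (conj-accept {x = y} ys z≤n)))
conj-injective (x ∷ xs) []       _  _  h = ⊥-elim (0≢1+n (trans (sym (h 0)) (conj-accept {x = x} xs z≤n)))
conj-injective (x ∷ xs) (y ∷ ys) dx dy h with <-cmp x y
... | tri< x<y _ _ = ⊥-elim (0≢1+n (begin
  0               ≡⟨ conj-head< xs dx x<y ⟨
  conj (x ∷ xs) y ≡⟨ h y ⟩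
  conj (y ∷ ys) y ≡⟨ conj-accept ys ≤-refl ⟩
  suc (conj ys y) ∎))
  where open ≡-Reasoning
... | tri> _ _ y<x = ⊥-elim (0≢1+n (begin
  0               ≡⟨ conj-head< ys dy y<x ⟨
  conj (y ∷ ys) x ≡⟨ h x ⟨
  conj (x ∷ xs) x ≡⟨ conj-accept xs ≤-refl ⟩
  suc (conj xs x) ∎))
  where open ≡-Reasoning
... | tri≈ _ refl _ = cong (x ∷_) (conj-injective xs ys (Linked.tail dx) (Linked.tail dy) h′)
  where
  h′ : ∀ k → conj xs k ≡ conj ys k
  h′ k with k ≤? x
  ... | yes k≤x = suc-injective (trans (sym (conj-accept xs k≤x)) (trans (h k) (conj-accept ys k≤x)))
  ... | no  k≰x = trans (sym (conj-reject xs k≰x)) (trans (h k) (conj-reject ys k≰x))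

InRange : ℕ → ℕ → ℕ → Set
InRange lo hi x = lo ≤ x × x ≤ hi

columns : List ℕ → ℕ → ℕ → List ℕ
columns xs lo zero    = []
columns xs lo (suc n) = conj xs (suc lo) ∷ columns xs (suc lo) n

length-columns : ∀ xs lo n → length (columns xs lo n) ≡ n
length-columns xs lo zero    = refl
length-columns xs lo (suc n) = cong suc (length-columns xs (suc lo) n)

columns-decreasing : ∀ xs lo n → Decreasing (columns xs lo n)
columns-decreasing xs lo zero          = []
columns-decreasing xs lo (suc zero)    = [-]
columns-decreasing xs lo (suc (suc n)) =
  conj-antitone xs (n≤1+n (suc lo)) ∷ columns-decreasing xs (suc lo) (suc n)

columns≤length : ∀ xs lo n → All (_≤ length xs) (columns xs lo n)
columns≤length xs lo zero    = []
columns≤length xs lo (suc n) = conj≤length xs (suc lo) ∷ columns≤length xs (suc lo) n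

conj-columns : ∀ xs ys lo n → columns xs lo n ≡ columns ys lo n →
               ∀ k → lo < k → k ≤ lo + n → conj xs k ≡ conj ys k
conj-columns xs ys lo zero    _ k lo<k k≤lo = ⊥-elim (<⇒≱ lo<k (subst (k ≤_) (+-identityʳ lo) k≤lo))
conj-columns xs ys lo (suc n) e k lo<k k≤lo+n with k ≟ suc lo
... | yes refl = ∷-injectiveˡ e
... | no  k≢ = conj-columns xs ys (suc lo) n (∷-injectiveʳ e) k
                 (≤∧≢⇒< lo<k (k≢ ∘′ sym)) (subst (k ≤_) (+-suc lo n) k≤lo+n)

columns-injective : ∀ xs ys lo n → Decreasing xs → Decreasing ys → length xs ≡ length ys →
                    All (InRange lo (lo + n)) xs → All (InRange lo (lo + n)) ys →
                    columns xs lo n ≡ columns ys lo n → xs ≡ ys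
columns-injective xs ys lo n dx dy len xs∈ ys∈ e = conj-injective xs ys dx dy conj≡
  where
  conj≡ : ∀ k → conj xs k ≡ conj ys k
  conj≡ k with k ≤? lo | k ≤? lo + n
  ... | yes k≤lo | _ = begin
    conj xs k ≡⟨ conj-all xs (All.map (λ x∈ → ≤-trans k≤lo (proj₁ x∈)) xs∈) ⟩
    length xs ≡⟨ len ⟩
    length ys ≡⟨ conj-all ys (All.map (λ y∈ → ≤-trans k≤lo (proj₁ y∈)) ys∈) ⟨
    conj ys k ∎
    where open ≡-Reasoning
  ... | no k≰lo | yes k≤hi = conj-columns xs ys lo n e k (≰⇒> k≰lo) k≤hi
  ... | no _    | no k≰hi = begin
    conj xs k ≡⟨ conj-none xs (All.map (λ x∈ → ≤-<-trans (proj₂ x∈) (≰⇒> k≰hi)) xs∈) ⟩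
    0         ≡⟨ conj-none ys (All.map (λ y∈ → ≤-<-trans (proj₂ y∈) (≰⇒> k≰hi)) ys∈) ⟨
    conj ys k ∎
    where open ≡-Reasoning

columns-∷-≤ : ∀ x xs lo n → x ≤ lo → columns (x ∷ xs) lo n ≡ columns xs lo n
columns-∷-≤ x xs lo zero    _    = refl
columns-∷-≤ x xs lo (suc n) x≤lo =
  cong₂ _∷_ (conj-reject xs (<⇒≱ (s≤s x≤lo))) (columns-∷-≤ x xs (suc lo) n (m≤n⇒m≤1+n x≤lo))

sum-columns-[] : ∀ lo n → sum (columns [] lo n) ≡ 0
sum-columns-[] lo zero    = refl
sum-columns-[] lo (suc n) = sum-columns-[] (suc lo) n

sum-columns-∷ : ∀ n lo x xs → lo ≤ x → x ≤ lo + n →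
                sum (columns (x ∷ xs) lo n) + lo ≡ x + sum (columns xs lo n)
sum-columns-∷ zero lo x xs lo≤x x≤lo =
  trans (≤-antisym lo≤x (subst (x ≤_) (+-identityʳ lo) x≤lo)) (sym (+-identityʳ x))
sum-columns-∷ (suc n) lo x xs lo≤x x≤hi with suc lo ≤? x
... | yes lo<x = begin
  conj (x ∷ xs) (suc lo) + s₁ + lo  ≡⟨ cong (λ c → c + s₁ + lo) (conj-accept xs lo<x) ⟩
  suc c + s₁ + lo                   ≡⟨ move-suc c s₁ lo ⟩
  c + (s₁ + suc lo)                 ≡⟨ cong (c +_) (sum-columns-∷ n (suc lo) x xs lo<x (subst (x ≤_) (+-suc lo n) x≤hi)) ⟩
  c + (x + s₀)                      ≡⟨ x∙yz≈y∙xz c x s₀ ⟩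
  x + (c + s₀)                      ∎
  where
  open ≡-Reasoning
  c  = conj xs (suc lo)
  s₁ = sum (columns (x ∷ xs) (suc lo) n)
  s₀ = sum (columns xs (suc lo) n)
  move-suc : ∀ a b c → suc a + b + c ≡ a + (b + suc c)
  move-suc = solve-∀
... | no lo≮x rewrite ≤-antisym (≤-pred (≰⇒> lo≮x)) lo≤x =
  trans (cong (λ cs → sum cs + lo) (columns-∷-≤ lo xs lo (suc n) ≤-refl)) (+-comm _ lo)

sum-columns : ∀ xs lo n → All (InRange lo (lo + n)) xs → sum (columns xs lo n) + lo * length xs ≡ sum xs
sum-columns []       lo n []                 = cong₂ _+_ (sum-columns-[] lo n) (*-zeroʳ lo)
sum-columns (x ∷ xs) lo n ((lo≤x , x≤hi) ∷ xs∈) = begin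
  sum (columns (x ∷ xs) lo n) + lo * suc (length xs)  ≡⟨ cong (s +_) (*-suc lo (length xs)) ⟩
  sum (columns (x ∷ xs) lo n) + (lo + lo * length xs) ≡⟨ +-assoc s lo (lo * length xs) ⟨
  (sum (columns (x ∷ xs) lo n) + lo) + lo * length xs ≡⟨ cong (_+ lo * length xs) (sum-columns-∷ n lo x xs lo≤x x≤hi) ⟩
  x + sum (columns xs lo n) + lo * length xs          ≡⟨ +-assoc x _ _ ⟩
  x + (sum (columns xs lo n) + lo * length xs)        ≡⟨ cong (x +_) (sum-columns xs lo n xs∈) ⟩
  x + sum xs                                          ∎
  where
  open ≡-Reasoning
  s = sum (columns (x ∷ xs) lo n)

sum-map-+ : ∀ c xs → sum (map (c +_) xs) ≡ c * length xs + sum xs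
sum-map-+ c []       = sym (trans (+-identityʳ _) (*-zeroʳ c))
sum-map-+ c (x ∷ xs) = begin
  c + x + sum (map (c +_) xs)      ≡⟨ cong (c + x +_) (sum-map-+ c xs) ⟩
  c + x + (c * length xs + sum xs)   ≡⟨ interchange c x _ _ ⟩
  c + c * length xs + (x + sum xs)   ≡⟨ cong (_+ (x + sum xs)) (*-suc c (length xs)) ⟨
  c * suc (length xs) + (x + sum xs) ∎
  where open ≡-Reasoning

sum-map-∸ : ∀ c xs → All (c ≤_) xs → sum (map (_∸ c) xs) + c * length xs ≡ sum xs
sum-map-∸ c []       []           = *-zeroʳ c
sum-map-∸ c (x ∷ xs) (c≤x ∷ c≤xs) = begin
  x ∸ c + sum (map (_∸ c) xs) + c * suc (length xs)    ≡⟨ cong (x ∸ c + sum (map (_∸ c) xs) +_) (*-suc c (length xs)) ⟩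
  x ∸ c + sum (map (_∸ c) xs) + (c + c * length xs)     ≡⟨ interchange (x ∸ c) _ c _ ⟩
  (x ∸ c + c) + (sum (map (_∸ c) xs) + c * length xs)   ≡⟨ cong₂ _+_ (m∸n+n≡m c≤x) (sum-map-∸ c xs c≤xs) ⟩
  x + sum xs                                            ∎
  where open ≡-Reasoning

-- For f₁ … f_r and x₁ … x_{r+2}, with i the first index such that f_i ≤ x_i (or i = r + 1),
-- the pair (f₁ … f_{i-1} x_{i+1} …, x₁ … x_i f_i …): the two sequences exchange their tails
-- at their first crossing, which is undone by crossing them again.
crossSwap : List ℕ → List ℕ → List ℕ × List ℕ
crossSwap fs       []       = fs , []
crossSwap []       (x ∷ xs) = xs , x ∷ []
crossSwap (f ∷ fs) (x ∷ xs) with f ≤? x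
... | yes _ = xs , x ∷ f ∷ fs
... | no  _ = f ∷ proj₁ (crossSwap fs xs) , x ∷ proj₂ (crossSwap fs xs)

crossSwap-accept : ∀ {f x} fs xs → f ≤ x → crossSwap (f ∷ fs) (x ∷ xs) ≡ (xs , x ∷ f ∷ fs)
crossSwap-accept {f} {x} fs xs f≤x with f ≤? x
... | yes _   = refl
... | no  f≰x = ⊥-elim (f≰x f≤x)

crossSwap-reject : ∀ {f x} fs xs → ¬ f ≤ x →
                   crossSwap (f ∷ fs) (x ∷ xs) ≡ (f ∷ proj₁ (crossSwap fs xs) , x ∷ proj₂ (crossSwap fs xs))
crossSwap-reject {f} {x} fs xs f≰x with f ≤? x
... | yes f≤x = ⊥-elim (f≰x f≤x)
... | no  _   = refl

crossSwap-involutive : ∀ fs xs → Decreasing xs → length xs ≡ 2 + length fs →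
                       uncurry crossSwap (crossSwap fs xs) ≡ (fs , xs)
crossSwap-involutive []       (x ∷ y ∷ [])      d _ = crossSwap-accept [] [] (Linked.head d)
crossSwap-involutive (f ∷ fs) (x ∷ y ∷ xs)      d l with f ≤? x
... | yes _   = crossSwap-accept xs (f ∷ fs) (Linked.head d)
... | no  f≰x = trans (crossSwap-reject _ _ f≰x)
  (cong (λ p → f ∷ proj₁ p , x ∷ proj₂ p) (crossSwap-involutive fs (y ∷ xs) (Linked.tail d) (suc-injective l)))

crossSwap-length : ∀ fs xs → length xs ≡ 2 + length fs →
                   length (proj₁ (crossSwap fs xs)) ≡ suc (length fs) × length (proj₂ (crossSwap fs xs)) ≡ suc (length fs)
crossSwap-length []       (x ∷ xs) l = suc-injective l , refl
crossSwap-length (f ∷ fs) (x ∷ xs) l with f ≤? x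
... | yes _ = suc-injective l , refl
... | no  _ = let l₁ , l₂ = crossSwap-length fs xs (suc-injective l) in cong suc l₁ , cong suc l₂

crossSwap-sum : ∀ fs xs → sum (proj₁ (crossSwap fs xs)) + sum (proj₂ (crossSwap fs xs)) ≡ sum fs + sum xs
crossSwap-sum fs       []       = refl
crossSwap-sum []       (x ∷ xs) = trans (cong (sum xs +_) (+-identityʳ x)) (+-comm (sum xs) x)
crossSwap-sum (f ∷ fs) (x ∷ xs) with f ≤? x
... | yes _ = x∙yz≈z∙yx (sum xs) x (f + sum fs)
... | no  _ = begin
  f + p + (x + q)           ≡⟨ interchange f p x q ⟩
  f + x + (p + q)           ≡⟨ cong (f + x +_) (crossSwap-sum fs xs) ⟩
  f + x + (sum fs + sum xs) ≡⟨ interchange f (sum fs) x (sum xs) ⟨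
  f + sum fs + (x + sum xs) ∎
  where
  open ≡-Reasoning
  p = sum (proj₁ (crossSwap fs xs))
  q = sum (proj₂ (crossSwap fs xs))

crossSwap₁-≤ : ∀ {b} fs xs → All (_≤ b) fs → All (_≤ b) xs → All (_≤ b) (proj₁ (crossSwap fs xs))
crossSwap₁-≤ fs       []       fs≤b _              = fs≤b
crossSwap₁-≤ []       (x ∷ xs) _    (_ ∷ xs≤b)     = xs≤b
crossSwap₁-≤ (f ∷ fs) (x ∷ xs) (f≤b ∷ fs≤b) (_ ∷ xs≤b) with f ≤? x
... | yes _ = xs≤b
... | no  _ = f≤b ∷ crossSwap₁-≤ fs xs fs≤b xs≤b

crossSwap₁-≥ : ∀ {c} fs xs → length xs ≡ 2 + length fs → All (c ≤_) xs → All (c ≤_) (proj₁ (crossSwap fs xs))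
crossSwap₁-≥ []       (x ∷ xs) _ (_ ∷ c≤xs) = c≤xs
crossSwap₁-≥ (f ∷ fs) (x ∷ xs) l (c≤x ∷ c≤xs) with f ≤? x
... | yes _   = c≤xs
... | no  f≰x = ≤-trans c≤x (<⇒≤ (≰⇒> f≰x)) ∷ crossSwap₁-≥ fs xs (suc-injective l) c≤xs

crossSwap₂-≤ : ∀ {b} fs xs → Decreasing fs → All (_≤ b) xs → All (_≤ b) (proj₂ (crossSwap fs xs))
crossSwap₂-≤ fs       []       _ _ = []
crossSwap₂-≤ []       (x ∷ xs) _ (x≤b ∷ _) = x≤b ∷ []
crossSwap₂-≤ (f ∷ fs) (x ∷ xs) d (x≤b ∷ xs≤b) with f ≤? x
... | yes f≤x = x≤b ∷ f≤b ∷ All.map (λ g≤f → ≤-trans g≤f f≤b) (decreasing⇒≤head d)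
  where f≤b = ≤-trans f≤x x≤b
... | no  _   = x≤b ∷ crossSwap₂-≤ fs xs (Linked.tail d) xs≤b

crossSwap₁-decreasing : ∀ fs xs → Decreasing fs → Decreasing xs → Decreasing (proj₁ (crossSwap fs xs))
crossSwap₁-decreasing fs       []       dfs _   = dfs
crossSwap₁-decreasing []       (x ∷ xs) _   dxs = Linked.tail dxs
crossSwap₁-decreasing (f ∷ fs) (x ∷ xs) dfs dxs with f ≤? x
... | yes _   = Linked.tail dxs
... | no  f≰x = decreasing-∷
  (crossSwap₁-≤ fs xs (decreasing⇒≤head dfs)
                 (All.map (λ y≤x → ≤-trans y≤x (<⇒≤ (≰⇒> f≰x))) (decreasing⇒≤head dxs)))
  (crossSwap₁-decreasing fs xs (Linked.tail dfs) (Linked.tail dxs))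

crossSwap₂-decreasing : ∀ fs xs → Decreasing fs → Decreasing xs → Decreasing (proj₂ (crossSwap fs xs))
crossSwap₂-decreasing fs       []       _   _   = []
crossSwap₂-decreasing []       (x ∷ xs) _   _   = [-]
crossSwap₂-decreasing (f ∷ fs) (x ∷ xs) dfs dxs with f ≤? x
... | yes f≤x = f≤x ∷ dfs
... | no  _   = decreasing-∷ (crossSwap₂-≤ fs xs (Linked.tail dfs) (decreasing⇒≤head dxs))
                             (crossSwap₂-decreasing fs xs (Linked.tail dfs) (Linked.tail dxs))

crossSwapTail : List ℕ → List ℕ → List ℕ × List ℕ
crossSwapTail fs []       = fs , []
crossSwapTail fs (a ∷ xs) = proj₁ (crossSwap fs xs) , a ∷ proj₂ (crossSwap fs xs)

crossSwapTail-involutive : ∀ fs xs → Decreasing xs → length xs ≡ 3 + length fs →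
                           uncurry crossSwapTail (crossSwapTail fs xs) ≡ (fs , xs)
crossSwapTail-involutive fs (a ∷ xs) d l =
  cong (λ p → proj₁ p , a ∷ proj₂ p) (crossSwap-involutive fs xs (Linked.tail d) (suc-injective l))

crossSwapTail-length : ∀ fs xs → length xs ≡ 3 + length fs →
                       length (proj₁ (crossSwapTail fs xs)) ≡ 1 + length fs ×
                       length (proj₂ (crossSwapTail fs xs)) ≡ 2 + length fs
crossSwapTail-length fs (a ∷ xs) l = let l₁ , l₂ = crossSwap-length fs xs (suc-injective l) in l₁ , cong suc l₂

crossSwapTail-sum : ∀ fs xs → sum (proj₁ (crossSwapTail fs xs)) + sum (proj₂ (crossSwapTail fs xs)) ≡ sum fs + sum xs
crossSwapTail-sum fs []       = refl
crossSwapTail-sum fs (a ∷ xs) = begin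
  p + (a + q)           ≡⟨ x∙yz≈y∙xz p a q ⟩
  a + (p + q)           ≡⟨ cong (a +_) (crossSwap-sum fs xs) ⟩
  a + (sum fs + sum xs) ≡⟨ x∙yz≈y∙xz (sum fs) a (sum xs) ⟨
  sum fs + (a + sum xs) ∎
  where
  open ≡-Reasoning
  p = sum (proj₁ (crossSwap fs xs))
  q = sum (proj₂ (crossSwap fs xs))

crossSwapTail₁-decreasing : ∀ fs xs → Decreasing fs → Decreasing xs → Decreasing (proj₁ (crossSwapTail fs xs))
crossSwapTail₁-decreasing fs []       dfs _ = dfs
crossSwapTail₁-decreasing fs (a ∷ xs) dfs d = crossSwap₁-decreasing fs xs dfs (Linked.tail d)

crossSwapTail₂-decreasing : ∀ fs xs → Decreasing fs → Decreasing xs → Decreasing (proj₂ (crossSwapTail fs xs))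
crossSwapTail₂-decreasing fs []       _   _ = []
crossSwapTail₂-decreasing fs (a ∷ xs) dfs d =
  decreasing-∷ (crossSwap₂-≤ fs xs dfs (decreasing⇒≤head d)) (crossSwap₂-decreasing fs xs dfs (Linked.tail d))

crossSwapTail₁-≤ : ∀ {b} fs xs → All (_≤ b) fs → All (_≤ b) xs → All (_≤ b) (proj₁ (crossSwapTail fs xs))
crossSwapTail₁-≤ fs []       fs≤b _          = fs≤b
crossSwapTail₁-≤ fs (a ∷ xs) fs≤b (_ ∷ xs≤b) = crossSwap₁-≤ fs xs fs≤b xs≤b

crossSwapTail₁-≥ : ∀ {c} fs xs → length xs ≡ 3 + length fs → All (c ≤_) xs → All (c ≤_) (proj₁ (crossSwapTail fs xs))
crossSwapTail₁-≥ fs (a ∷ xs) l (_ ∷ c≤xs) = crossSwap₁-≥ fs xs (suc-injective l) c≤xs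

crossSwapTail₂-≤ : ∀ {b} fs xs → Decreasing fs → All (_≤ b) xs → All (_≤ b) (proj₂ (crossSwapTail fs xs))
crossSwapTail₂-≤ fs []       _   _            = []
crossSwapTail₂-≤ fs (a ∷ xs) dfs (a≤b ∷ xs≤b) = a≤b ∷ crossSwap₂-≤ fs xs dfs xs≤b

drop-length-++ : ∀ (xs : List ℕ) {ys} → drop (length xs) (xs ++ ys) ≡ ys
drop-length-++ []       = refl
drop-length-++ (x ∷ xs) = drop-length-++ xs

part-++ : ∀ xs ys k → part (xs ++ ys) (suc (length xs + k)) ≡ part ys (suc k)
part-++ []           ys k = refl
part-++ (x ∷ [])     ys k = refl
part-++ (x ∷ y ∷ xs) ys k = part-++ (y ∷ xs) ys k

part-++ˡ : ∀ {P : ℕ → Set} xs ys k → k < length xs → All P xs → P (part (xs ++ ys) (suc k))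
part-++ˡ (x ∷ xs)     ys zero    _   (px ∷ _)   = px
part-++ˡ (x ∷ y ∷ xs) ys (suc k) k<l (_ ∷ pxs) = part-++ˡ (y ∷ xs) ys k (≤-pred k<l) pxs
part-++ˡ (x ∷ [])     ys (suc k) (s≤s ()) _

part-All : ∀ {P : ℕ → Set} xs k → P 0 → All P xs → P (part xs k)
part-All []       k             p0 _          = p0
part-All (x ∷ xs) zero          p0 _          = p0
part-All (x ∷ xs) (suc zero)    _  (px ∷ _)   = px
part-All (x ∷ xs) (suc (suc k)) p0 (_ ∷ pxs)  = part-All xs (suc k) p0 pxs

part-applyUpTo : ∀ (f : ℕ → ℕ) n i → i < n → part (applyUpTo f n) (suc i) ≡ f i
part-applyUpTo f (suc n)       zero    _   = refl
part-applyUpTo f (suc (suc n)) (suc i) i<n = part-applyUpTo (f ∘′ suc) (suc n) i (≤-pred i<n)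
part-applyUpTo f (suc zero)    (suc i) (s≤s ())

part-applyUpTo-≥ : ∀ (f : ℕ → ℕ) n i → n ≤ i → part (applyUpTo f n) (suc i) ≡ 0
part-applyUpTo-≥ f zero          i       _       = refl
part-applyUpTo-≥ f (suc zero)    (suc i) _       = refl
part-applyUpTo-≥ f (suc (suc n)) (suc i) (s≤s n≤i) = part-applyUpTo-≥ (f ∘′ suc) (suc n) i n≤i

part-fixedPoint-++ : ∀ xs ys i → All (length xs <_) xs → All (_≤ length xs) ys →
                     part (xs ++ ys) (suc i) ≡ i → part ys 1 ≡ length xs
part-fixedPoint-++ xs ys i xs> ys≤ e with i <? length xs
... | yes i<l = ⊥-elim (<-irrefl (sym e) (<-trans i<l (part-++ˡ xs ys i i<l xs>)))
... | no  i≮l = trans (cong (λ k → part ys (suc k)) (sym k≡0)) (trans e′ i≡l)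
  where
  k = i ∸ length xs
  i≡l+k : i ≡ length xs + k
  i≡l+k = sym (m+[n∸m]≡n (≮⇒≥ i≮l))
  e′ : part ys (suc k) ≡ i
  e′ = trans (sym (part-++ xs ys k)) (trans (cong (λ n → part (xs ++ ys) (suc n)) (sym i≡l+k)) e)
  i≡l : i ≡ length xs
  i≡l = ≤-antisym (subst (_≤ length xs) e′ (part-All ys (suc k) z≤n ys≤)) (≮⇒≥ i≮l)
  k≡0 : k ≡ 0
  k≡0 = trans (cong (_∸ length xs) i≡l) (n∸n≡0 (length xs))

durfeeAux-++ : ∀ i xs {y ys} → All (λ x → i + length xs ≤ suc x) xs → y < i + length xs →
               durfeeAux i (xs ++ y ∷ ys) ≡ length xs
durfeeAux-++ i [] {y} _ y<i with i ≤? y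
... | yes i≤y = ⊥-elim (<⇒≱ (subst (y <_) (+-identityʳ i) y<i) i≤y)
... | no  _   = refl
durfeeAux-++ i (x ∷ xs) {y} (p ∷ ps) y< with i ≤? x
... | yes _ = cong suc (durfeeAux-++ (suc i) xs (All.map (λ {z} → subst (_≤ suc z) i+1+l≡) ps)
                                      (subst (y <_) i+1+l≡ y<))
  where i+1+l≡ = +-suc i (length xs)
... | no i≰x = ⊥-elim (i≰x (≤-pred (≤-trans (s≤s (m≤m+n i _)) (subst (_≤ suc x) (+-suc i (length xs)) p))))

durfee-++ : ∀ xs {y ys} → All (length xs ≤_) xs → y ≤ length xs → durfee (xs ++ y ∷ ys) ≡ length xs
durfee-++ xs xs≥ y≤ = durfeeAux-++ 1 xs (All.map s≤s xs≥) (s≤s y≤)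

beta-++ : ∀ xs {y ys} → All (length xs ≤_) xs → y ≤ length xs → beta (xs ++ y ∷ ys) ≡ y ∷ ys
beta-++ xs xs≥ y≤ = trans (cong (λ d → drop d (xs ++ _)) (durfee-++ xs xs≥ y≤)) (drop-length-++ xs)

durfeeAux-next : ∀ i xs {y ys} → drop (durfeeAux i xs) xs ≡ y ∷ ys → y < i + durfeeAux i xs
durfeeAux-next i (x ∷ xs) {y} e with i ≤? x
... | yes _ = subst (y <_) (sym (+-suc i _)) (durfeeAux-next (suc i) xs e)
durfeeAux-next i (x ∷ xs) refl | no i≰x = subst (x <_) (sym (+-identityʳ i)) (≰⇒> i≰x)

beta-head≤durfee : ∀ xs {y ys} → beta xs ≡ y ∷ ys → y ≤ durfee xs
beta-head≤durfee xs e = ≤-pred (durfeeAux-next 1 xs e)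

beta≤durfee : ∀ xs ys → beta xs ≡ ys → Decreasing ys → All (_≤ durfee xs) ys
beta≤durfee xs []       _  _ = []
beta≤durfee xs (y ∷ ys) β≡ d = decreasing-head≤⇒≤ d (beta-head≤durfee xs β≡)

length-alpha : ∀ xs → length (alpha xs) ≡ part xs 1 ∸ durfee xs
length-alpha xs = trans (length-map _ (upTo (part xs 1 ∸ durfee xs))) (length-upTo _)

part-alpha : ∀ xs i → i < part xs 1 ∸ durfee xs → part (alpha xs) (suc i) ≡ conj xs (durfee xs + suc i)
part-alpha xs i i< = trans (cong (λ ys → part ys (suc i)) (map-applyUpTo id _ (part xs 1 ∸ durfee xs)))
                           (part-applyUpTo _ _ i i<)

part-alpha-≥ : ∀ xs i → part xs 1 ∸ durfee xs ≤ i → part (alpha xs) (suc i) ≡ 0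
part-alpha-≥ xs i ≤i = trans (cong (λ ys → part ys (suc i)) (map-applyUpTo id _ (part xs 1 ∸ durfee xs)))
                             (part-applyUpTo-≥ _ _ i ≤i)

decreasing⇒≤part₁ : ∀ xs → Decreasing xs → All (_≤ part xs 1) xs
decreasing⇒≤part₁ []       _ = []
decreasing⇒≤part₁ (x ∷ xs) d = decreasing-head≤⇒≤ d ≤-refl

part₁≡⇒∷ : ∀ {j} xs → 1 ≤ j → part xs 1 ≡ j → ∃ λ ys → xs ≡ j ∷ ys
part₁≡⇒∷ []       1≤j e    = ⊥-elim (<⇒≢ 1≤j e)
part₁≡⇒∷ (x ∷ xs) _   refl = xs , refl

rankSet-0⇒fixedPoint : ∀ xs → 1 ≤ length xs → InRankSet (ℤ.+ 0) xs → ∃ λ i → part xs (suc i) ≡ i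
rankSet-0⇒fixedPoint xs _   (inj₁ (i , _ , e)) = i , sym (ℤ.+-injective (ℤ.i-j≡0⇒i≡j (ℤ.+ i) _ (sym e)))
rankSet-0⇒fixedPoint xs 1≤l (inj₂ (m , e))     = ⊥-elim (<⇒≢ (≤-trans 1≤l (m≤m+n _ m)) (ℤ.+-injective e))

record Q̄₂Shape (j : ℕ) (T B : List ℕ) : Set where
  field
    3≤j          : 3 ≤ j
    length-T     : length T ≡ j
    T-decreasing : Decreasing T
    T-range      : All (InRange (j + 3) (j + length B)) T
    B-decreasing : Decreasing B
    B-range      : All (InRange 3 j) B

Qbar2⇒conj : ∀ xs → InQbar2 xs → conj xs (durfee xs + 3) ≡ durfee xs
Qbar2⇒conj xs (_ , 1≤j , _ , _ , _ , α₃≡j , _) with 2 <? part xs 1 ∸ durfee xs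
... | yes 2<n = trans (sym (part-alpha xs 2 2<n)) α₃≡j
... | no  2≮n = ⊥-elim (<⇒≢ 1≤j (trans (sym (part-alpha-≥ xs 2 (≮⇒≥ 2≮n))) α₃≡j))

Qbar2⇒part₁≤ : ∀ xs {B} → InQbar2 xs → beta xs ≡ durfee xs ∷ B → part xs 1 ∸ durfee xs ≤ length B
Qbar2⇒part₁≤ xs (_ , _ , ℓα<ℓβ , _) β≡ =
  ≤-pred (subst₂ (λ a b → suc a ≤ b) (length-alpha xs) (cong length β≡) ℓα<ℓβ)

split-durfee : ∀ xs k → Decreasing xs → conj xs k ≡ durfee xs →
               ∃ λ T → xs ≡ T ++ beta xs × length T ≡ durfee xs × All (k ≤_) T
split-durfee xs k dxs conj≡ with split-threshold k xs dxs
... | T , S , xs≡ , T≥ , S< = T , trans xs≡ (cong (T ++_) (sym β≡S)) , length-T , T≥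
  where
  length-T : length T ≡ durfee xs
  length-T = trans (sym (conj-threshold k T S T≥ S<)) (trans (cong (λ ys → conj ys k) (sym xs≡)) conj≡)
  β≡S : beta xs ≡ S
  β≡S = trans (cong (drop (durfee xs)) xs≡)
              (trans (cong (λ d → drop d (T ++ S)) (sym length-T)) (drop-length-++ T))

Qbar2⇒beta : ∀ xs T → Decreasing xs → InQbar2 xs → xs ≡ T ++ beta xs → length T ≡ durfee xs →
             All (durfee xs + 3 ≤_) T → ∃ λ B → beta xs ≡ durfee xs ∷ B
Qbar2⇒beta xs T dxs (rank0 , 1≤j , _) xs≡ length-T T≥ =
  part₁≡⇒∷ (beta xs) 1≤j (trans (part-fixedPoint-++ T (beta xs) i T> β≤ fixedPoint) length-T)
  where
  j = durfee xs
  1≤length : 1 ≤ length xs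
  1≤length = subst (λ ys → 1 ≤ length ys) (sym xs≡)
    (subst (1 ≤_) (sym (length-++ T)) (≤-trans 1≤j (≤-trans (≤-reflexive (sym length-T)) (m≤m+n _ _))))
  i = proj₁ (rankSet-0⇒fixedPoint xs 1≤length rank0)
  fixedPoint : part (T ++ beta xs) (suc i) ≡ i
  fixedPoint = subst (λ ys → part ys (suc i) ≡ i) xs≡ (proj₂ (rankSet-0⇒fixedPoint xs 1≤length rank0))
  T> : All (length T <_) T
  T> = subst (λ l → All (l <_) T) (sym length-T) (All.map (<-≤-trans (m<m+n j z<s)) T≥)
  β≤ : All (_≤ length T) (beta xs)
  β≤ = subst (λ l → All (_≤ l) (beta xs)) (sym length-T)
             (beta≤durfee xs (beta xs) refl (decreasing-++⁻ʳ T (subst Decreasing xs≡ dxs)))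

Q̄₂Decomposition : List ℕ → Set
Q̄₂Decomposition xs = ∃₂ λ T B → xs ≡ T ++ durfee xs ∷ B × Q̄₂Shape (durfee xs) T B

decompose : ∀ xs → IsPartition xs → InQbar2 xs → Q̄₂Decomposition xs
decompose xs (dxs , _) q@(_ , _ , _ , _ , _ , _ , β≥3) with split-durfee xs (durfee xs + 3) dxs (Qbar2⇒conj xs q)
... | T , xs≡ , length-T , T≥ with Qbar2⇒beta xs T dxs q xs≡ length-T T≥
...   | B , β≡ = T , B , trans xs≡ (cong (T ++_) β≡) , shape
  where
  j = durfee xs
  jB≥3 : All (3 ≤_) (j ∷ B)
  jB≥3 = subst (All (3 ≤_)) β≡ β≥3
  jB-decreasing : Decreasing (j ∷ B)
  jB-decreasing = subst Decreasing β≡ (decreasing-++⁻ʳ T (subst Decreasing xs≡ dxs))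
  part₁≤ : part xs 1 ≤ j + length B
  part₁≤ = ≤-trans (m≤n+m∸n (part xs 1) j) (+-monoʳ-≤ j (Qbar2⇒part₁≤ xs q β≡))
  T≤ : All (_≤ j + length B) T
  T≤ = ++⁻ˡ T (subst (All (_≤ j + length B)) xs≡
                     (All.map (λ x≤ → ≤-trans x≤ part₁≤) (decreasing⇒≤part₁ xs dxs)))
  shape : Q̄₂Shape j T B
  shape = record
    { 3≤j          = All.head jB≥3
    ; length-T     = length-T
    ; T-decreasing = decreasing-++⁻ˡ T (subst Decreasing xs≡ dxs)
    ; T-range      = All.zip (T≥ , T≤)
    ; B-decreasing = Linked.tail jB-decreasing
    ; B-range      = All.zip (All.tail jB≥3 , decreasing⇒≤head jB-decreasing)
    }

All⇒∃ : ∀ {P : ℕ → Set} {xs} → 1 ≤ length xs → All P xs → ∃ P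
All⇒∃ {xs = x ∷ _} _ (px ∷ _) = x , px

module Construction (j : ℕ) (T B : List ℕ) where

  m : ℕ
  m = length B

  A F A′ B′ X D μ : List ℕ
  A  = map (_∸ (j + 2)) T
  F  = columns B 3 (j ∸ 3)
  A′ = proj₁ (crossSwapTail F A)
  B′ = proj₂ (crossSwapTail F A)
  X  = map (suc j +_) A′
  D  = map (2 +_) (columns B′ 0 (m ∸ 1))
  μ  = (suc j + m) ∷ X ++ suc j ∷ suc j ∷ suc j ∷ D

module ConstructionProperties {j T B} (s : Q̄₂Shape j T B) where

  open Construction j T B public
  open Q̄₂Shape s

  j₀ : ℕ
  j₀ = j ∸ 3

  j≡ : j ≡ 3 + j₀
  j≡ = sym (m+[n∸m]≡n 3≤j)

  T≥ : All (j + 3 ≤_) T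
  T≥ = All.map proj₁ T-range

  3≤m : 3 ≤ m
  3≤m = let _ , t≥ , t≤ = All⇒∃ (≤-trans (s≤s z≤n) (≤-trans 3≤j (≤-reflexive (sym length-T)))) T-range
        in +-cancelˡ-≤ j 3 m (≤-trans t≥ t≤)

  m₀ : ℕ
  m₀ = m ∸ 1

  m≡ : m ≡ suc m₀
  m≡ = sym (m+[n∸m]≡n (≤-trans (s≤s z≤n) 3≤m))

  length-A : length A ≡ 3 + length F
  length-A = trans (length-map _ T) (trans length-T (trans j≡ (cong (3 +_) (sym (length-columns B 3 j₀)))))

  A-decreasing : Decreasing A
  A-decreasing = decreasing-map-∸ (j + 2) T-decreasing

  1≤A : All (1 ≤_) A
  1≤A = map⁺ (All.map (λ {t} j+3≤t → m<n⇒0<n∸m (subst (_≤ t) (+-suc j 2) j+3≤t)) T≥)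

  A≤ : All (_≤ m ∸ 2) A
  A≤ = map⁺ (All.map (λ {t} (_ , t≤) → subst (t ∸ (j + 2) ≤_) ([m+n]∸[m+o]≡n∸o j m 2) (∸-monoˡ-≤ (j + 2) t≤))
                     T-range)

  F-decreasing : Decreasing F
  F-decreasing = columns-decreasing B 3 j₀

  length-A′ : length A′ ≡ suc j₀
  length-A′ = trans (proj₁ (crossSwapTail-length F A length-A)) (cong suc (length-columns B 3 j₀))

  length-B′ : length B′ ≡ 2 + j₀
  length-B′ = trans (proj₂ (crossSwapTail-length F A length-A)) (cong (2 +_) (length-columns B 3 j₀))

  B′≤ : All (_≤ m₀) B′
  B′≤ = All.map (λ b≤ → ≤-trans b≤ (∸-monoʳ-≤ m (s≤s z≤n))) (crossSwapTail₂-≤ F A F-decreasing A≤)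

  B′-decreasing : Decreasing B′
  B′-decreasing = crossSwapTail₂-decreasing F A F-decreasing A-decreasing

  length-X : length X ≡ suc j₀
  length-X = trans (length-map _ A′) length-A′

  X-decreasing : Decreasing X
  X-decreasing = decreasing-map-+ (suc j) (crossSwapTail₁-decreasing F A F-decreasing A-decreasing)

  X-range : All (InRange (2 + j) (suc j + m)) X
  X-range = map⁺ (All.zip (All.map (λ {a} 1≤a → subst (_≤ suc j + a) (+-comm (suc j) 1) (+-monoʳ-≤ (suc j) 1≤a)) A′≥1
                          , All.map (+-monoʳ-≤ (suc j)) A′≤m))
    where
    A′≥1 : All (1 ≤_) A′
    A′≥1 = crossSwapTail₁-≥ F A length-A 1≤A
    A′≤m : All (_≤ m) A′
    A′≤m = crossSwapTail₁-≤ F A (columns≤length B 3 j₀) (All.map (λ a≤ → ≤-trans a≤ (m∸n≤m m 2)) A≤)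

  length-D : length D ≡ m₀
  length-D = trans (length-map _ (columns B′ 0 m₀)) (length-columns B′ 0 m₀)

  D-decreasing : Decreasing D
  D-decreasing = decreasing-map-+ 2 (columns-decreasing B′ 0 m₀)

  D-range : All (InRange 2 (suc j)) D
  D-range = map⁺ (All.map (λ {c} c≤ → m≤m+n 2 c
                                    , subst (2 + c ≤_) (cong suc (sym j≡)) (+-monoʳ-≤ 2 (≤-trans c≤ (≤-reflexive length-B′))))
                          (columns≤length B′ 0 m₀))

  square : List ℕ
  square = (suc j + m) ∷ X ++ suc j ∷ suc j ∷ []

  μ≡ : μ ≡ square ++ suc j ∷ D
  μ≡ = cong ((suc j + m) ∷_) (sym (++-assoc X (suc j ∷ suc j ∷ []) (suc j ∷ D)))

  length-square : length square ≡ suc j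
  length-square = cong suc (trans (length-++ X) (trans (cong (_+ 2) length-X) (trans (+-comm (suc j₀) 2) (sym j≡))))

  square≥ : All (suc j ≤_) square
  square≥ = m≤m+n (suc j) m ∷ ++⁺ (All.map (λ x∈ → ≤-trans (n≤1+n _) (proj₁ x∈)) X-range) (≤-refl ∷ ≤-refl ∷ [])

  square≥length : All (length square ≤_) square
  square≥length = subst (λ l → All (l ≤_) square) (sym length-square) square≥

  durfee-μ : durfee μ ≡ suc j
  durfee-μ = trans (cong durfee μ≡) (trans (durfee-++ square square≥length (≤-reflexive (sym length-square))) length-square)

  beta-μ : beta μ ≡ suc j ∷ D
  beta-μ = trans (cong beta μ≡) (beta-++ square square≥length (≤-reflexive (sym length-square)))

  below : List ℕ
  below = suc j ∷ suc j ∷ suc j ∷ D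

  below≤ : All (_≤ suc j) below
  below≤ = ≤-refl ∷ ≤-refl ∷ ≤-refl ∷ All.map proj₂ D-range

  μ-decreasing : Decreasing μ
  μ-decreasing = decreasing-∷ (++⁺ (All.map proj₂ X-range) (All.map (λ y≤ → ≤-trans y≤ (m≤m+n (suc j) m)) below≤))
    (decreasing-++ X-decreasing (≤-refl ∷ ≤-refl ∷ decreasing-∷ (All.map proj₂ D-range) D-decreasing)
                   (All.map (λ x∈ → ≤-trans (n≤1+n _) (proj₁ x∈)) X-range) below≤)

  μ-positive : All (1 ≤_) μ
  μ-positive = s≤s z≤n ∷ ++⁺ (All.map (λ x∈ → ≤-trans (s≤s z≤n) (proj₁ x∈)) X-range)
                             (s≤s z≤n ∷ s≤s z≤n ∷ s≤s z≤n ∷ All.map (λ d∈ → ≤-trans (s≤s z≤n) (proj₁ d∈)) D-range)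

  length-μ : length μ ≡ suc j + m
  length-μ = begin
    suc (length (X ++ below))          ≡⟨ cong suc (length-++ X) ⟩
    suc (length X + (3 + length D))    ≡⟨ cong₂ (λ a b → suc (a + (3 + b))) length-X length-D ⟩
    suc (suc j₀ + (3 + m₀))            ≡⟨ regroup j₀ m₀ ⟩
    suc (3 + j₀) + suc m₀              ≡⟨ cong₂ (λ a b → suc a + b) j≡ m≡ ⟨
    suc j + m                          ∎
    where
    open ≡-Reasoning
    regroup : ∀ a b → suc (suc a + (3 + b)) ≡ suc (3 + a) + suc b
    regroup = solve-∀

  conj-μ : conj μ (suc j + 1) ≡ 2 + j₀
  conj-μ = trans (conj-threshold (suc j + 1) ((suc j + m) ∷ X) below above< below<) (cong suc length-X)
    where
    above< : All (suc j + 1 ≤_) ((suc j + m) ∷ X)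
    above< = +-monoʳ-≤ (suc j) (≤-trans (s≤s z≤n) 3≤m)
           ∷ All.map (λ {x} x∈ → subst (_≤ x) (+-comm 1 (suc j)) (proj₁ x∈)) X-range
    below< : All (_< suc j + 1) below
    below< = All.map (λ {y} y≤ → subst (y <_) (+-comm 1 (suc j)) (s≤s y≤)) below≤

  μ-Pbar2 : InPbar2 μ
  μ-Pbar2 = rank , subst (1 ≤_) (sym durfee-μ) (s≤s z≤n) , ℓα≡ℓβ , α₁+2 , β₁ , β≥2
    where
    rank : length μ ≤ part μ 1
    rank = ≤-reflexive length-μ
    m≡αlength : part μ 1 ∸ durfee μ ≡ m
    m≡αlength = trans (cong (suc j + m ∸_) durfee-μ) (m+n∸m≡n (suc j) m)
    ℓα≡ℓβ : length (alpha μ) ≡ length (beta μ)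
    ℓα≡ℓβ = trans (length-alpha μ) (trans m≡αlength (trans m≡ (sym (trans (cong length beta-μ) (cong suc length-D)))))
    α₁+2 : part (alpha μ) 1 + 2 ≡ durfee μ
    α₁+2 = begin
      part (alpha μ) 1 + 2         ≡⟨ cong (_+ 2) (part-alpha μ 0 (subst (0 <_) (sym m≡αlength) (≤-trans (s≤s z≤n) 3≤m))) ⟩
      conj μ (durfee μ + 1) + 2    ≡⟨ cong (λ d → conj μ (d + 1) + 2) durfee-μ ⟩
      conj μ (suc j + 1) + 2       ≡⟨ cong (_+ 2) conj-μ ⟩
      2 + j₀ + 2                   ≡⟨ cong suc (trans (+-comm (suc j₀) 2) (sym j≡)) ⟩
      suc j                        ≡⟨ durfee-μ ⟨
      durfee μ                     ∎
      where open ≡-Reasoning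
    β₁ : part (beta μ) 1 ≡ durfee μ
    β₁ = trans (cong (λ ys → part ys 1) beta-μ) (sym durfee-μ)
    β≥2 : All (2 ≤_) (beta μ)
    β≥2 = subst (All (2 ≤_)) (sym beta-μ) (s≤s (≤-trans (s≤s z≤n) 3≤j) ∷ All.map proj₁ D-range)

  sum-X : sum X ≡ suc j * suc j₀ + sum A′
  sum-X = trans (sum-map-+ (suc j) A′) (cong (λ l → suc j * l + sum A′) length-A′)

  sum-D : sum D ≡ 2 * m₀ + sum B′
  sum-D = begin
    sum D                                                 ≡⟨ sum-map-+ 2 (columns B′ 0 m₀) ⟩
    2 * length (columns B′ 0 m₀) + sum (columns B′ 0 m₀)  ≡⟨ cong₂ (λ l s → 2 * l + s) (length-columns B′ 0 m₀) sum-columns-B′ ⟩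
    2 * m₀ + sum B′                                       ∎
    where
    open ≡-Reasoning
    sum-columns-B′ : sum (columns B′ 0 m₀) ≡ sum B′
    sum-columns-B′ = trans (sym (+-identityʳ _)) (sum-columns B′ 0 m₀ (All.map (z≤n ,_) B′≤))

  sum-F : sum F + 3 * m ≡ sum B
  sum-F = sum-columns B 3 j₀ (All.map (λ {b} (3≤b , b≤j) → 3≤b , subst (b ≤_) j≡ b≤j) B-range)

  sum-A : sum A + (j + 2) * j ≡ sum T
  sum-A = subst (λ l → sum A + (j + 2) * l ≡ sum T) length-T
                (sum-map-∸ (j + 2) T (All.map (≤-trans (+-monoʳ-≤ j (n≤1+n 2))) T≥))

  sum-μ : sum μ ≡ sum (T ++ j ∷ B)
  sum-μ = begin
    suc j + m + sum (X ++ below)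
      ≡⟨ cong (suc j + m +_) (trans (sum-++ X below) (cong₂ (λ x d → x + (suc j + (suc j + (suc j + d)))) sum-X sum-D)) ⟩
    suc j + m + (suc j * suc j₀ + sum A′ + (suc j + (suc j + (suc j + (2 * m₀ + sum B′)))))
      ≡⟨ regroup (suc j) m j₀ m₀ (sum A′) (sum B′) ⟩
    sum A′ + sum B′ + (suc j + m + suc j * suc j₀ + 3 * suc j + 2 * m₀)
      ≡⟨ cong (_+ (suc j + m + suc j * suc j₀ + 3 * suc j + 2 * m₀)) (crossSwapTail-sum F A) ⟩
    sum F + sum A + (suc j + m + suc j * suc j₀ + 3 * suc j + 2 * m₀)
      ≡⟨ subst₂ (λ j m → sum F + sum A + (suc j + m + suc j * suc j₀ + 3 * suc j + 2 * m₀)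
                         ≡ sum A + (j + 2) * j + (j + (sum F + 3 * m)))
                (sym j≡) (sym m≡) (weights j₀ m₀ (sum F) (sum A)) ⟩
    sum A + (j + 2) * j + (j + (sum F + 3 * m))
      ≡⟨ cong₂ (λ t b → t + (j + b)) sum-A sum-F ⟩
    sum T + (j + sum B)
      ≡⟨ sum-++ T (j ∷ B) ⟨
    sum (T ++ j ∷ B) ∎
    where
    open ≡-Reasoning
    regroup : ∀ J m j₀ m₀ a b → J + m + (J * suc j₀ + a + (J + (J + (J + (2 * m₀ + b)))))
                               ≡ a + b + (J + m + J * suc j₀ + 3 * J + 2 * m₀)
    regroup = solve-∀
    weights : ∀ j₀ m₀ f a → f + a + (suc (3 + j₀) + suc m₀ + suc (3 + j₀) * suc j₀ + 3 * suc (3 + j₀) + 2 * m₀)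
                          ≡ a + (3 + j₀ + 2) * (3 + j₀) + (3 + j₀ + (f + 3 * suc m₀))
    weights = solve-∀

  B′-range : All (InRange 0 (0 + m₀)) B′
  B′-range = All.map (z≤n ,_) B′≤

  B-range′ : All (InRange 3 (3 + j₀)) B
  B-range′ = All.map (λ {b} (3≤b , b≤j) → 3≤b , subst (b ≤_) j≡ b≤j) B-range

  T≥j+2 : All (j + 2 ≤_) T
  T≥j+2 = All.map (≤-trans (+-monoʳ-≤ j (n≤1+n 2))) T≥

map-∸-injective : ∀ c xs ys → All (c ≤_) xs → All (c ≤_) ys → map (_∸ c) xs ≡ map (_∸ c) ys → xs ≡ ys
map-∸-injective c []       []       _            _            _ = refl
map-∸-injective c (x ∷ xs) (y ∷ ys) (c≤x ∷ c≤xs) (c≤y ∷ c≤ys) e =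
  cong₂ _∷_ x≡y (map-∸-injective c xs ys c≤xs c≤ys (∷-injectiveʳ e))
  where
  x≡y : x ≡ y
  x≡y = trans (sym (m∸n+n≡m c≤x)) (trans (cong (_+ c) (∷-injectiveˡ e)) (m∸n+n≡m c≤y))

-- μ is read back from the top: its first row gives m, the next j − 2 rows give A′, the rows below
-- the square give B′ through its columns, crossing again gives (F, A), and from these T and B.
construction-injective-fixedSide : ∀ {j T₁ B₁ T₂ B₂} (s₁ : Q̄₂Shape j T₁ B₁) (s₂ : Q̄₂Shape j T₂ B₂) →
                                   Construction.μ j T₁ B₁ ≡ Construction.μ j T₂ B₂ → T₁ ≡ T₂ × B₁ ≡ B₂
construction-injective-fixedSide {j} {T₁} {B₁} {T₂} {B₂} s₁ s₂ e = T₁≡T₂ , B₁≡B₂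
  where
  module C₁ = ConstructionProperties s₁
  module C₂ = ConstructionProperties s₂
  m₁≡m₂ : C₁.m ≡ C₂.m
  m₁≡m₂ = +-cancelˡ-≡ (suc j) _ _ (∷-injectiveˡ e)
  split≡ : C₁.X ≡ C₂.X × C₁.below ≡ C₂.below
  split≡ = ++-cancel-≡length C₁.X C₂.X (trans C₁.length-X (sym C₂.length-X)) (∷-injectiveʳ e)
  A′≡ : C₁.A′ ≡ C₂.A′
  A′≡ = map-injective (+-cancelˡ-≡ (suc j) _ _) (proj₁ split≡)
  columns≡ : columns C₁.B′ 0 C₁.m₀ ≡ columns C₂.B′ 0 C₁.m₀
  columns≡ = trans (map-injective (+-cancelˡ-≡ 2 _ _) (∷-injectiveʳ (∷-injectiveʳ (∷-injectiveʳ (proj₂ split≡)))))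
                   (cong (λ m → columns C₂.B′ 0 (m ∸ 1)) (sym m₁≡m₂))
  B′≡ : C₁.B′ ≡ C₂.B′
  B′≡ = columns-injective C₁.B′ C₂.B′ 0 C₁.m₀ C₁.B′-decreasing C₂.B′-decreasing
          (trans C₁.length-B′ (sym C₂.length-B′)) C₁.B′-range
          (subst (λ m → All (InRange 0 (0 + (m ∸ 1))) C₂.B′) (sym m₁≡m₂) C₂.B′-range) columns≡
  F,A≡ : (C₁.F , C₁.A) ≡ (C₂.F , C₂.A)
  F,A≡ = begin
    (C₁.F , C₁.A)                             ≡⟨ crossSwapTail-involutive C₁.F C₁.A C₁.A-decreasing C₁.length-A ⟨
    uncurry crossSwapTail (C₁.A′ , C₁.B′)     ≡⟨ cong₂ crossSwapTail A′≡ B′≡ ⟩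
    uncurry crossSwapTail (C₂.A′ , C₂.B′)     ≡⟨ crossSwapTail-involutive C₂.F C₂.A C₂.A-decreasing C₂.length-A ⟩
    (C₂.F , C₂.A)                             ∎
    where open ≡-Reasoning
  T₁≡T₂ : T₁ ≡ T₂
  T₁≡T₂ = map-∸-injective (j + 2) T₁ T₂ C₁.T≥j+2 C₂.T≥j+2 (cong proj₂ F,A≡)
  B₁≡B₂ : B₁ ≡ B₂
  B₁≡B₂ = columns-injective B₁ B₂ 3 C₁.j₀ (Q̄₂Shape.B-decreasing s₁) (Q̄₂Shape.B-decreasing s₂) m₁≡m₂
            C₁.B-range′ C₂.B-range′ (cong proj₁ F,A≡)

construction-injective : ∀ {j₁ T₁ B₁ j₂ T₂ B₂} → Q̄₂Shape j₁ T₁ B₁ → Q̄₂Shape j₂ T₂ B₂ →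
                         Construction.μ j₁ T₁ B₁ ≡ Construction.μ j₂ T₂ B₂ →
                         T₁ ++ j₁ ∷ B₁ ≡ T₂ ++ j₂ ∷ B₂
construction-injective s₁ s₂ e
  with suc-injective (trans (sym (ConstructionProperties.durfee-μ s₁))
                            (trans (cong durfee e) (ConstructionProperties.durfee-μ s₂)))
... | refl = let T≡ , B≡ = construction-injective-fixedSide s₁ s₂ e in cong₂ (λ T B → T ++ _ ∷ B) T≡ B≡

image : ∀ {n xs} → sum xs ≡ n → Q̄₂Decomposition xs → Pbar2 n
image sum≡n (T , B , xs≡ , s) =
  (μ , (μ-decreasing , μ-positive) , trans sum-μ (trans (cong sum (sym xs≡)) sum≡n)) , μ-Pbar2
  where open ConstructionProperties s

image-injective : ∀ {n xs ys} (p : sum xs ≡ n) (q : sum ys ≡ n) d d′ →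
                  parts (image p d) ≡ parts (image q d′) → xs ≡ ys
image-injective _ _ (_ , _ , xs≡ , s₁) (_ , _ , ys≡ , s₂) e =
  trans xs≡ (trans (construction-injective s₁ s₂ e) (sym ys≡))

Q̄₂→P̄₂ : ∀ {n} → Qbar2 n → Pbar2 n
Q̄₂→P̄₂ ((xs , isP , sum≡n) , q) = image sum≡n (decompose xs isP q)

lemma5p2 : (n : ℕ) → Σ (Qbar2 n → Pbar2 n)
    (λ f → ∀ x y → parts (f x) ≡ parts (f y) → parts x ≡ parts y)
lemma5p2 n = Q̄₂→P̄₂ , injective
  where
  injective : ∀ x y → parts (Q̄₂→P̄₂ x) ≡ parts (Q̄₂→P̄₂ y) → parts x ≡ parts y
  injective ((xs , isPx , px) , qx) ((ys , isPy , py) , qy) =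
    image-injective px py (decompose xs isPx qx) (decompose ys isPy qy)
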